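{- Let $n \geq 2$ be an integer, $N := n-\frac{1}{24}$, and let $j$ be a positive integer with $j \leq \frac{\sqrt{N}}{4}$. Then \[ \frac{p(n) - 2p(n-j) + p(n-2j)}{p(n)} > 0. \]
   Context: $p(m)$ denotes the number of partitions of the nonnegative integer $m$ ($p(0)=1$). -}

module Defs where

open import Data.Nat using (ℕ; zero; suc; _∸_; _≤_; _≤?_)
open import Data.List using (List; []; _∷_; [_]; map; concatMap; length; filter; upTo)

-- partitionsBounded f m k : the list of all partitions of m, each written as a
-- non-increasing list of positive parts, whose largest part is at most k.  The fuel f must be ≥ m (each step removes
-- a positive part); it is always called with f = m below.
partitionsBounded : ℕ → ℕ → ℕ → List (List ℕ)
partitionsBounded _       zero    _ = [ [] ]
partitionsBounded zero    (suc m) _ = []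
partitionsBounded (suc f) (suc m) k =
  concatMap (λ i → map (i ∷_) (partitionsBounded f (suc m ∸ i) i))
            (filter (_≤? suc m) (map suc (upTo k)))

partitionsOf : ℕ → List (List ℕ)
partitionsOf m = partitionsBounded m m m

p : ℕ → ℕ
p m = length (partitionsOf m)

-- Lowering the unique largest part of a partition by one, or removing one copy of a repeated
-- largest part, gives p (m + 1) = p m + q (m + 1), where q x counts the partitions of x whose
-- largest part is repeated.  Split by the value of that largest part, q x is a sum of counts of
-- partitions with a fixed largest part, each nondecreasing in x, and the term for largest part 3
-- grows strictly once x ≥ 9.  Hence p n − 2 p (n − j) + p (n − 2j) = Σ_{i<j} (q (n−j+1+i) − q (n−2j+1+i))
-- is a sum of nonnegative terms, the last of which is positive; the bound on j only has to
-- guarantee 2j ≤ n and n ≥ 10.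
module Submission where

open import Defs
open import Data.Nat using (ℕ; zero; suc; _+_; _*_; _∸_; _≤_; _<_; _≤?_; _<?_; z≤n; s≤s; s≤s⁻¹; z<s; _≤′_; ≤′-refl; ≤′-step)
open import Data.Nat.Properties
open import Data.Nat.Induction using (<-rec)
open import Algebra.Properties.CommutativeSemigroup +-commutativeSemigroup using (xy∙z≈xz∙y) renaming (interchange to +-interchange)
open import Data.List using (List; []; _∷_; [_]; map; concatMap; length; filter; upTo; _++_)
open import Data.List.Properties
  using (length-++; length-map; map-++; upTo-∷ʳ; ++-identityʳ; concatMap-++; filter-++; filter-accept; filter-reject)
open import Function using (_∘_)
open import Relation.Nullary using (¬_; yes; no; contradiction)
open import Relation.Binary.PropositionalEquality using (_≡_; refl; sym; trans; cong; cong₂; subst; subst₂; module ≡-Reasoning)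

monotone-by-steps : ∀ (f : ℕ → ℕ) → (∀ n → f n ≤ f (suc n)) → ∀ {m n} → m ≤ n → f m ≤ f n
monotone-by-steps f step m≤n = go (≤⇒≤′ m≤n)
  where
  go : ∀ {n} → _ ≤′ n → f _ ≤ f n
  go ≤′-refl       = ≤-refl
  go (≤′-step m≤n) = ≤-trans (go m≤n) (step _)

module SecondDifference (f g : ℕ → ℕ) (f-suc : ∀ m → f (suc m) ≡ f m + g (suc m))
                        (g-mono : ∀ {x y} → x ≤ y → g x ≤ g y) where

  window-suc : ∀ j a b → f (suc j + a) + f b ≡ (f (j + a) + f b) + g (suc (j + a))
  window-suc j a b = trans (cong (_+ f b) (f-suc (j + a))) (xy∙z≈xz∙y (f (j + a)) _ (f b))

  window-mono : ∀ j {a b} → a ≤ b → f (j + a) + f b ≤ f (j + b) + f a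
  window-mono zero    {a} {b} a≤b = ≤-reflexive (+-comm (f a) (f b))
  window-mono (suc j) {a} {b} a≤b = subst₂ _≤_ (sym (window-suc j a b)) (sym (window-suc j b a))
    (+-mono-≤ (window-mono j a≤b) (g-mono (s≤s (+-monoʳ-≤ j a≤b))))

  window-strict : ∀ j {a b} → a ≤ b → g (suc (j + a)) < g (suc (j + b)) →
                  f (suc j + a) + f b < f (suc j + b) + f a
  window-strict j {a} {b} a≤b g< = subst₂ _<_ (sym (window-suc j a b)) (sym (window-suc j b a))
    (+-mono-≤-< (window-mono j a≤b) g<)

  second-difference-pos : ∀ t a → g (suc (t + a)) < g (suc (t + (suc t + a))) →
                          2 * f (suc t + a) < f (suc t + (suc t + a)) + f a
  second-difference-pos t a g< = subst (_< f (suc t + (suc t + a)) + f a)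
    (cong (f (suc t + a) +_) (sym (+-identityʳ (f (suc t + a)))))
    (window-strict t (m≤n+m a (suc t)) g<)

count : ℕ → ℕ → ℕ → ℕ
count f m k = length (partitionsBounded f m k)

extensions : ℕ → ℕ → ℕ → List (List ℕ)
extensions f m i = map (i ∷_) (partitionsBounded f (suc m ∸ i) i)

map-suc-upTo-suc : ∀ k → map suc (upTo (suc k)) ≡ map suc (upTo k) ++ [ suc k ]
map-suc-upTo-suc k = trans (cong (map suc) (sym (upTo-∷ʳ k))) (map-++ suc (upTo k) [ k ])

count-suc : ∀ f m k → count (suc f) (suc m) (suc k) ≡
  count (suc f) (suc m) k + length (concatMap (extensions f m) (filter (_≤? suc m) [ suc k ]))
count-suc f m k = begin
  length (concatMap E (filter P? (map suc (upTo (suc k)))))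
    ≡⟨ cong (length ∘ concatMap E ∘ filter P?) (map-suc-upTo-suc k) ⟩
  length (concatMap E (filter P? (map suc (upTo k) ++ [ suc k ])))
    ≡⟨ cong (length ∘ concatMap E) (filter-++ P? (map suc (upTo k)) [ suc k ]) ⟩
  length (concatMap E (filter P? (map suc (upTo k)) ++ filter P? [ suc k ]))
    ≡⟨ cong length (concatMap-++ E (filter P? (map suc (upTo k))) (filter P? [ suc k ])) ⟩
  length (concatMap E (filter P? (map suc (upTo k))) ++ concatMap E (filter P? [ suc k ]))
    ≡⟨ length-++ (concatMap E (filter P? (map suc (upTo k)))) ⟩
  count (suc f) (suc m) k + length (concatMap E (filter P? [ suc k ])) ∎
  where
  open ≡-Reasoning
  E = extensions f m
  P? = _≤? suc m

count-suc-≤ : ∀ f m k → suc k ≤ suc m →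
  count (suc f) (suc m) (suc k) ≡ count (suc f) (suc m) k + count f (m ∸ k) (suc k)
count-suc-≤ f m k k<m = begin
  count (suc f) (suc m) (suc k)                 ≡⟨ count-suc f m k ⟩
  C + length (concatMap E (filter P? [ suc k ])) ≡⟨ cong (λ xs → C + length (concatMap E xs)) (filter-accept P? k<m) ⟩
  C + length (E (suc k) ++ [])                   ≡⟨ cong (λ xs → C + length xs) (++-identityʳ (E (suc k))) ⟩
  C + length (E (suc k))                         ≡⟨ cong (C +_) (length-map (suc k ∷_) (partitionsBounded f (m ∸ k) (suc k))) ⟩
  C + count f (m ∸ k) (suc k)                   ∎
  where
  open ≡-Reasoning
  C = count (suc f) (suc m) k
  E = extensions f m
  P? = _≤? suc m

count-suc-> : ∀ f m k → ¬ suc k ≤ suc m → count (suc f) (suc m) (suc k) ≡ count (suc f) (suc m) k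
count-suc-> f m k k≮m = begin
  count (suc f) (suc m) (suc k)                 ≡⟨ count-suc f m k ⟩
  C + length (concatMap E (filter P? [ suc k ])) ≡⟨ cong (λ xs → C + length (concatMap E xs)) (filter-reject P? k≮m) ⟩
  C + 0                                         ≡⟨ +-identityʳ C ⟩
  C                                             ∎
  where
  open ≡-Reasoning
  C = count (suc f) (suc m) k
  E = extensions f m
  P? = _≤? suc m

count-fuel : ∀ f f′ m k → m ≤ f → m ≤ f′ → count f m k ≡ count f′ m k
count-fuel f f′ zero k _ _ = refl
count-fuel (suc f) (suc f′) (suc m) zero _ _ = refl
count-fuel (suc f) (suc f′) (suc m) (suc k) m≤f m≤f′ with suc k ≤? suc m
... | yes k<m = begin
  count (suc f) (suc m) (suc k)                       ≡⟨ count-suc-≤ f m k k<m ⟩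
  count (suc f) (suc m) k + count f (m ∸ k) (suc k)   ≡⟨ cong₂ _+_ (count-fuel (suc f) (suc f′) (suc m) k m≤f m≤f′)
                                                                   (count-fuel f f′ (m ∸ k) (suc k) (rest m≤f) (rest m≤f′)) ⟩
  count (suc f′) (suc m) k + count f′ (m ∸ k) (suc k) ≡⟨ count-suc-≤ f′ m k k<m ⟨
  count (suc f′) (suc m) (suc k)                      ∎
  where
  open ≡-Reasoning
  rest : ∀ {g} → suc m ≤ suc g → m ∸ k ≤ g
  rest m≤g = ≤-trans (m∸n≤m m k) (≤-pred m≤g)
... | no k≮m = begin
  count (suc f) (suc m) (suc k)  ≡⟨ count-suc-> f m k k≮m ⟩
  count (suc f) (suc m) k        ≡⟨ count-fuel (suc f) (suc f′) (suc m) k m≤f m≤f′ ⟩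
  count (suc f′) (suc m) k       ≡⟨ count-suc-> f′ m k k≮m ⟨
  count (suc f′) (suc m) (suc k) ∎
  where open ≡-Reasoning

pBounded : ℕ → ℕ → ℕ
pBounded m k = count m m k

-- The number of partitions of m with largest part exactly k.
pLargest : ℕ → ℕ → ℕ
pLargest m k with k ≤? m
... | yes _ = pBounded (m ∸ k) k
... | no _  = 0

pLargest-≤ : ∀ {m k} → k ≤ m → pLargest m k ≡ pBounded (m ∸ k) k
pLargest-≤ {m} {k} k≤m with k ≤? m
... | yes _  = refl
... | no k≰m = contradiction k≤m k≰m

pLargest-> : ∀ {m k} → m < k → pLargest m k ≡ 0
pLargest-> {m} {k} m<k with k ≤? m
... | yes k≤m = contradiction k≤m (<⇒≱ m<k)
... | no _    = refl

pBounded-suc : ∀ m k → pBounded m (suc k) ≡ pBounded m k + pLargest m (suc k)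
pBounded-suc zero k = cong suc (sym (pLargest-> {0} {suc k} z<s))
pBounded-suc (suc m) k with k ≤? m
... | yes k≤m = begin
  pBounded (suc m) (suc k)                       ≡⟨ count-suc-≤ m m k (s≤s k≤m) ⟩
  pBounded (suc m) k + count m (m ∸ k) (suc k)   ≡⟨ cong (pBounded (suc m) k +_) (count-fuel m (m ∸ k) (m ∸ k) (suc k) (m∸n≤m m k) ≤-refl) ⟩
  pBounded (suc m) k + pBounded (m ∸ k) (suc k)  ≡⟨ cong (pBounded (suc m) k +_) (pLargest-≤ (s≤s k≤m)) ⟨
  pBounded (suc m) k + pLargest (suc m) (suc k)  ∎
  where open ≡-Reasoning
... | no k≰m = begin
  pBounded (suc m) (suc k)                       ≡⟨ count-suc-> m m k (k≰m ∘ s≤s⁻¹) ⟩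
  pBounded (suc m) k                             ≡⟨ +-identityʳ _ ⟨
  pBounded (suc m) k + 0                         ≡⟨ cong (pBounded (suc m) k +_) (pLargest-> (s≤s (≰⇒> k≰m))) ⟨
  pBounded (suc m) k + pLargest (suc m) (suc k)  ∎
  where open ≡-Reasoning

pBounded-1 : ∀ m → pBounded m 1 ≡ 1
pBounded-1 zero    = refl
pBounded-1 (suc m) = begin
  pBounded (suc m) 1      ≡⟨ pBounded-suc (suc m) 0 ⟩
  0 + pLargest (suc m) 1  ≡⟨ pLargest-≤ {suc m} {1} (s≤s z≤n) ⟩
  pBounded m 1            ≡⟨ pBounded-1 m ⟩
  1                       ∎
  where open ≡-Reasoning

-- Largest part suc k either occurs once (lower it by one) or repeatedly (remove one copy).
pLargest-suc : ∀ m k → pLargest (suc m) (suc k) ≡ pLargest m k + pLargest (m ∸ k) (suc k)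
pLargest-suc m k with m <? k
... | no m≮k = begin
  pLargest (suc m) (suc k)                      ≡⟨ pLargest-≤ (s≤s (≮⇒≥ m≮k)) ⟩
  pBounded (m ∸ k) (suc k)                      ≡⟨ pBounded-suc (m ∸ k) k ⟩
  pBounded (m ∸ k) k + pLargest (m ∸ k) (suc k) ≡⟨ cong (_+ pLargest (m ∸ k) (suc k)) (pLargest-≤ (≮⇒≥ m≮k)) ⟨
  pLargest m k + pLargest (m ∸ k) (suc k)       ∎
  where open ≡-Reasoning
... | yes m<k = begin
  pLargest (suc m) (suc k)                      ≡⟨ pLargest-> (s≤s m<k) ⟩
  0                                             ≡⟨ pLargest-> {0} {suc k} z<s ⟨
  pLargest 0 (suc k)                            ≡⟨ cong (λ x → pLargest x (suc k)) (m≤n⇒m∸n≡0 (<⇒≤ m<k)) ⟨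
  pLargest (m ∸ k) (suc k)                      ≡⟨ cong (_+ pLargest (m ∸ k) (suc k)) (pLargest-> m<k) ⟨
  pLargest m k + pLargest (m ∸ k) (suc k)       ∎
  where open ≡-Reasoning

-- The number of partitions of m whose largest part is at most k and occurs at least twice:
-- removing one copy of the largest part i leaves a partition of m ∸ i with largest part i.
pRepeated : ℕ → ℕ → ℕ
pRepeated m zero    = 0
pRepeated m (suc k) = pRepeated m k + pLargest (m ∸ suc k) (suc k)

pBounded-suc-suc : ∀ m k → pBounded (suc m) (suc k) ≡ pBounded m k + pRepeated (suc m) (suc k)
pBounded-suc-suc m zero = begin
  pBounded (suc m) 1          ≡⟨ pBounded-1 (suc m) ⟩
  1                           ≡⟨ pBounded-1 m ⟨
  pBounded m 1                ≡⟨ pBounded-suc m 0 ⟩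
  pBounded m 0 + pLargest m 1 ∎
  where open ≡-Reasoning
pBounded-suc-suc m (suc k) = begin
  pBounded (suc m) (suc (suc k))
    ≡⟨ pBounded-suc (suc m) (suc k) ⟩
  pBounded (suc m) (suc k) + pLargest (suc m) (suc (suc k))
    ≡⟨ cong₂ _+_ (pBounded-suc-suc m k) (pLargest-suc m (suc k)) ⟩
  (pBounded m k + R) + (pLargest m (suc k) + pLargest (m ∸ suc k) (suc (suc k)))
    ≡⟨ +-interchange (pBounded m k) R (pLargest m (suc k)) _ ⟩
  (pBounded m k + pLargest m (suc k)) + (R + pLargest (m ∸ suc k) (suc (suc k)))
    ≡⟨ cong (_+ pRepeated (suc m) (suc (suc k))) (pBounded-suc m k) ⟨
  pBounded m (suc k) + pRepeated (suc m) (suc (suc k))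
    ∎
  where
  open ≡-Reasoning
  R = pRepeated (suc m) (suc k)

p-suc : ∀ m → p (suc m) ≡ p m + pRepeated (suc m) (suc m)
p-suc m = pBounded-suc-suc m m

pBounded-monoˡ-from-pLargest : ∀ m → (∀ k → pLargest m (suc k) ≤ pLargest (suc m) (suc k)) →
  ∀ k → pBounded m (suc k) ≤ pBounded (suc m) (suc k)
pBounded-monoˡ-from-pLargest m pLargest-mono zero =
  ≤-reflexive (trans (pBounded-1 m) (sym (pBounded-1 (suc m))))
pBounded-monoˡ-from-pLargest m pLargest-mono (suc k) =
  subst₂ _≤_ (sym (pBounded-suc m (suc k))) (sym (pBounded-suc (suc m) (suc k)))
    (+-mono-≤ (pBounded-monoˡ-from-pLargest m pLargest-mono k) (pLargest-mono (suc k)))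

pLargest-monoˡ : ∀ m k → pLargest m (suc k) ≤ pLargest (suc m) (suc k)
pLargest-monoˡ = <-rec (λ m → ∀ k → pLargest m (suc k) ≤ pLargest (suc m) (suc k)) step
  where
  step : ∀ m → (∀ {m′} → m′ < m → ∀ k → pLargest m′ (suc k) ≤ pLargest (suc m′) (suc k)) →
         ∀ k → pLargest m (suc k) ≤ pLargest (suc m) (suc k)
  step m rec k with m <? suc k
  ... | yes m≤k = subst (_≤ pLargest (suc m) (suc k)) (sym (pLargest-> m≤k)) z≤n
  ... | no m≰k = begin
    pLargest m (suc k)                 ≡⟨ pLargest-≤ k<m ⟩
    pBounded (m ∸ suc k) (suc k)       ≤⟨ pBounded-monoˡ-from-pLargest (m ∸ suc k) (rec (∸-monoʳ-< z<s k<m)) k ⟩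
    pBounded (suc (m ∸ suc k)) (suc k) ≡⟨ cong (λ x → pBounded x (suc k)) (+-∸-assoc 1 k<m) ⟨
    pBounded (suc m ∸ suc k) (suc k)   ≡⟨ pLargest-≤ (m≤n⇒m≤1+n k<m) ⟨
    pLargest (suc m) (suc k)           ∎
    where
    open ≤-Reasoning
    k<m : suc k ≤ m
    k<m = ≮⇒≥ m≰k

pLargest-mono-≤ : ∀ k {m n} → m ≤ n → pLargest m (suc k) ≤ pLargest n (suc k)
pLargest-mono-≤ k = monotone-by-steps (λ m → pLargest m (suc k)) (λ m → pLargest-monoˡ m k)

pRepeated-monoˡ : ∀ m k → pRepeated m k ≤ pRepeated (suc m) k
pRepeated-monoˡ m zero    = ≤-refl
pRepeated-monoˡ m (suc k) =
  +-mono-≤ (pRepeated-monoˡ m k) (pLargest-mono-≤ k (∸-monoʳ-≤ m (n≤1+n k)))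

pRepeated-diag-mono : ∀ {m n} → m ≤ n → pRepeated m m ≤ pRepeated n n
pRepeated-diag-mono = monotone-by-steps (λ m → pRepeated m m)
  (λ m → ≤-trans (pRepeated-monoˡ m m) (m≤m+n _ _))

pBounded-2-suc-suc : ∀ m → pBounded (2 + m) 2 ≡ suc (pBounded m 2)
pBounded-2-suc-suc m = begin
  pBounded (2 + m) 2                      ≡⟨ pBounded-suc (2 + m) 1 ⟩
  pBounded (2 + m) 1 + pLargest (2 + m) 2 ≡⟨ cong₂ _+_ (pBounded-1 (2 + m)) (pLargest-≤ {2 + m} {2} (s≤s (s≤s z≤n))) ⟩
  suc (pBounded m 2)                      ∎
  where open ≡-Reasoning

pBounded-3-expand : ∀ z → pBounded (3 + z) 3 ≡ pBounded (3 + z) 2 + pBounded z 2 + pLargest z 3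
pBounded-3-expand z = begin
  pBounded (3 + z) 3                                 ≡⟨ pBounded-suc (3 + z) 2 ⟩
  pBounded (3 + z) 2 + pLargest (3 + z) 3            ≡⟨ cong (pBounded (3 + z) 2 +_) (pLargest-≤ {3 + z} {3} (s≤s (s≤s (s≤s z≤n)))) ⟩
  pBounded (3 + z) 2 + pBounded z 3                  ≡⟨ cong (pBounded (3 + z) 2 +_) (pBounded-suc z 2) ⟩
  pBounded (3 + z) 2 + (pBounded z 2 + pLargest z 3) ≡⟨ +-assoc (pBounded (3 + z) 2) _ _ ⟨
  pBounded (3 + z) 2 + pBounded z 2 + pLargest z 3   ∎
  where open ≡-Reasoning

-- pBounded x 2 = ⌊x/2⌋ + 1 grows at every other x; pairing the increments at z and at 3 + z,
-- which have opposite parity, avoids a case split on parity.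
pBounded-3-strict : ∀ z → pBounded (3 + z) 3 < pBounded (4 + z) 3
pBounded-3-strict z = begin-strict
  pBounded (3 + z) 3                          ≡⟨ pBounded-3-expand z ⟩
  pBounded (3 + z) 2 + a + pLargest z 3       ≡⟨ cong (λ x → x + a + pLargest z 3) (pBounded-2-suc-suc (1 + z)) ⟩
  suc (b + a) + pLargest z 3                  ≡⟨ cong (λ x → suc x + pLargest z 3) (+-comm b a) ⟩
  suc (a + b) + pLargest z 3                  <⟨ +-mono-<-≤ (n<1+n (suc (a + b))) (pLargest-monoˡ z 2) ⟩
  suc (suc a) + b + pLargest (1 + z) 3        ≡⟨ cong (λ x → x + b + pLargest (1 + z) 3) pBounded-4+z ⟨
  pBounded (4 + z) 2 + b + pLargest (1 + z) 3 ≡⟨ pBounded-3-expand (1 + z) ⟨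
  pBounded (4 + z) 3                          ∎
  where
  open ≤-Reasoning
  a = pBounded z 2
  b = pBounded (1 + z) 2
  pBounded-4+z : pBounded (4 + z) 2 ≡ suc (suc a)
  pBounded-4+z = trans (pBounded-2-suc-suc (2 + z)) (cong suc (pBounded-2-suc-suc z))

pRepeated-strictˡ : ∀ z k → pRepeated (9 + z) (3 + k) < pRepeated (10 + z) (3 + k)
pRepeated-strictˡ z zero =
  +-mono-≤-< (pRepeated-monoˡ (9 + z) 2)
    (subst₂ _<_ (sym (pLargest-≤ {6 + z} {3} (s≤s (s≤s (s≤s z≤n))))) (sym (pLargest-≤ {7 + z} {3} (s≤s (s≤s (s≤s z≤n)))))
      (pBounded-3-strict z))
pRepeated-strictˡ z (suc k) =
  +-mono-<-≤ (pRepeated-strictˡ z k) (pLargest-mono-≤ (3 + k) (∸-monoʳ-≤ (9 + z) (n≤1+n (3 + k))))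

pRepeated-diag-strict : ∀ {m} → 9 ≤ m → pRepeated m m < pRepeated (suc m) (suc m)
pRepeated-diag-strict {m} 9≤m = subst (λ x → pRepeated x x < pRepeated (suc x) (suc x)) (m+[n∸m]≡n 9≤m)
  (<-≤-trans (pRepeated-strictˡ (m ∸ 9) (6 + (m ∸ 9))) (m≤m+n _ _))

p-second-difference-pos : ∀ t a → 10 ≤ suc t + (suc t + a) → 2 * p (suc t + a) < p (suc t + (suc t + a)) + p a
p-second-difference-pos t a 10≤n = second-difference-pos t a (begin-strict
  pRepeated (suc (t + a)) (suc (t + a))                     ≤⟨ pRepeated-diag-mono (m≤n+m (suc (t + a)) t) ⟩
  pRepeated (t + (suc t + a)) (t + (suc t + a))             <⟨ pRepeated-diag-strict (≤-pred 10≤n) ⟩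
  pRepeated (suc (t + (suc t + a))) (suc (t + (suc t + a))) ∎)
  where
  open ≤-Reasoning
  open SecondDifference p (λ m → pRepeated m m) p-suc pRepeated-diag-mono

384j²≤24n∸1⇒16j²≤n : ∀ n j → 384 * (j * j) ≤ 24 * n ∸ 1 → 16 * (j * j) ≤ n
384j²≤24n∸1⇒16j²≤n n j h = *-cancelˡ-≤ 24 (begin
  24 * (16 * (j * j))  ≡⟨ *-assoc 24 16 (j * j) ⟨
  384 * (j * j)        ≤⟨ h ⟩
  24 * n ∸ 1           ≤⟨ m∸n≤m (24 * n) 1 ⟩
  24 * n               ∎)
  where open ≤-Reasoning

-- The hypothesis 2 ≤ n is implied by the bound on j.
theorem2p3 : (n j : ℕ) → 2 ≤ n → 1 ≤ j → 384 * (j * j) ≤ 24 * n ∸ 1 →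
    2 * p (n ∸ j) < p n + p (n ∸ 2 * j)
theorem2p3 n zero    _ () _
theorem2p3 n (suc t) _ _  h =
  subst (λ x → 2 * p x < p n + p a) j+a≡n∸j
    (subst (λ x → 2 * p (j + a) < p x + p a) j+[j+a]≡n
      (p-second-difference-pos t a (subst (10 ≤_) (sym j+[j+a]≡n) 10≤n)))
  where
  j = suc t
  a = n ∸ 2 * j
  16j²≤n : 16 * (j * j) ≤ n
  16j²≤n = 384j²≤24n∸1⇒16j²≤n n j h
  10≤n : 10 ≤ n
  10≤n = ≤-trans (≤-trans (m≤m+n 10 6) (m≤m*n 16 (j * j))) 16j²≤n
  2j≤n : 2 * j ≤ n
  2j≤n = ≤-trans (*-mono-≤ (m≤m+n 2 14) (m≤m*n j j)) 16j²≤n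
  j+[j+a]≡n : j + (j + a) ≡ n
  j+[j+a]≡n = trans (trans (sym (+-assoc j j a)) (cong (λ x → j + x + a) (sym (+-identityʳ j)))) (m+[n∸m]≡n 2j≤n)
  j+a≡n∸j : j + a ≡ n ∸ j
  j+a≡n∸j = trans (sym (m+n∸m≡n j (j + a))) (cong (_∸ j) j+[j+a]≡n)
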